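{- For $0\le k\le n$, \[ B^{\mathrm{fmaj}}_{n,n-k}(q)=\sum_{\ell=0}^{k} q^{(n-k)(2\ell-n-k)}\,B_{n,n-\ell}(q)\,{n-\ell\brack k-\ell}_{q^2}. \]
   Context: $[k]_q=1+q+\dots+q^{k-1}$, $[0]_q=0$, $[n]_q!=\prod_{i=1}^n[i]_q$, ${n\brack k}_q=\frac{[n]_q!}{[k]_q![n-k]_q!}$, and ${n\brack k}_{q^2}$ is this with $q$ replaced by $q^2$. $\mathcal{B}_n$ is the group of signed permutations of $[n]$, written $\pi=\pi_1\cdots\pi_n$, with $\pi_0=0$ and the usual order on integers. $\mathrm{Des}_B(\pi)=\{i\in\{0,\dots,n-1\}:\pi_i>\pi_{i+1}\}$, $\mathrm{des}_B(\pi)=|\mathrm{Des}_B(\pi)|$, $\mathrm{neg}(\pi)$ is the number of negative entries, $\mathrm{fmaj}(\pi)=\sum_{i\in\mathrm{Des}_B(\pi)}2i+\mathrm{neg}(\pi)$, and $B_{n,k}(q)=\sum_{\pi\in\mathcal{B}_n,\,\mathrm{des}_B(\pi)=k}q^{\mathrm{fmaj}(\pi)}$. Let $\mathcal{B}^{>}_{n,k}=\{(\pi,S):\pi\in\mathcal{B}_n,\ S\subseteq\mathrm{Des}_B(\pi),\ |S|=k\}$ (descent-starred signed permutations; the elements of $S$ are the starred descents). For $(\pi,S)$ with $\pi\in\mathcal{B}_n$ put $\mathrm{fmaj}((\pi,S))=\mathrm{fmaj}(\pi)-\sum_{j\in S}\bigl(2|\mathrm{Des}_B(\pi)\cap\{j,j+1,\dots,n-1\}|-1\bigr)$,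 and $B^{\mathrm{fmaj}}_{n,k}(q)=\sum_{(\pi,S)\in\mathcal{B}^{>}_{n,k}}q^{\mathrm{fmaj}((\pi,S))}$. -}

module Defs where

open import Data.Bool using (Bool; true; false; if_then_else_; _∧_; not)
open import Data.Nat as ℕ using (ℕ; zero; suc; _∸_)
open import Data.Integer as ℤ using (ℤ; +_; -[1+_]; ∣_∣)
import Data.Integer.Properties as ℤP
open import Data.Rational as ℚ using (ℚ; 0ℚ; 1ℚ; _÷_; ≢-nonZero)
open import Data.Rational.Properties using (_≟_)
open import Data.List using (List; []; _∷_; map; concatMap; filterᵇ; length; foldr; upTo; _++_; applyUpTo)
open import Relation.Nullary using (does; yes; no)

_^ℕ_ : ℚ → ℕ → ℚ
q ^ℕ zero  = 1ℚ
q ^ℕ suc n = q ℚ.* (q ^ℕ n)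

-- total division (only ever used with nonzero denominators)
_÷'_ : ℚ → ℚ → ℚ
a ÷' b with b ≟ 0ℚ
... | yes _  = 0ℚ
... | no b≢0 = _÷_ a b {{≢-nonZero b≢0}}

_^ℤ_ : ℚ → ℤ → ℚ
q ^ℤ (+ n)      = q ^ℕ n
q ^ℤ -[1+ n ]   = 1ℚ ÷' (q ^ℕ suc n)

sumℚ : List ℚ → ℚ
sumℚ = foldr ℚ._+_ 0ℚ

qInt : ℕ → ℚ → ℚ
qInt k q = sumℚ (map (q ^ℕ_) (upTo k))

qFact : ℕ → ℚ → ℚ
qFact zero    q = 1ℚ
qFact (suc n) q = qInt (suc n) q ℚ.* qFact n q

qBinom : ℕ → ℕ → ℚ → ℚ
qBinom n k q = qFact n q ÷' (qFact k q ℚ.* qFact (n ∸ k) q)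

signedLetters : ℕ → List ℤ
signedLetters n = concatMap (λ i → (+ suc i) ∷ ℤ.- (+ suc i) ∷ []) (upTo n)

words : ℕ → List ℤ → List (List ℤ)
words zero    L = [] ∷ []
words (suc m) L = concatMap (λ x → map (x ∷_) (words m L)) L

absNotIn : ℤ → List ℤ → Bool
absNotIn x []       = true
absNotIn x (y ∷ ys) = not (does (∣ x ∣ ℕ.≟ ∣ y ∣)) ∧ absNotIn x ys

distinctAbs : List ℤ → Bool
distinctAbs []       = true
distinctAbs (x ∷ xs) = absNotIn x xs ∧ distinctAbs xs

-- 𝓑ₙ: words of length n over ±[n] whose absolute values are distinct
-- (equivalently |π₁|⋯|πₙ| is a permutation of [n])
signedPerms : ℕ → List (List ℤ)
signedPerms n = filterᵇ distinctAbs (words n (signedLetters n))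

-- Des_B(π) = { i ∈ {0,…,n-1} : πᵢ > πᵢ₊₁ } with π₀ = 0, listed increasingly
desGo : ℕ → ℤ → List ℤ → List ℕ
desGo i prev []       = []
desGo i prev (x ∷ xs) =
  if does (x ℤP.<? prev) then i ∷ desGo (suc i) x xs else desGo (suc i) x xs

DesB : List ℤ → List ℕ
DesB π = desGo 0 (+ 0) π

desB : List ℤ → ℕ
desB π = length (DesB π)

neg : List ℤ → ℕ
neg π = length (filterᵇ (λ x → does (x ℤP.<? + 0)) π)

sumℕ : List ℕ → ℕ
sumℕ = foldr ℕ._+_ 0

fmaj : List ℤ → ℕ
fmaj π = sumℕ (map (λ i → 2 ℕ.* i) (DesB π)) ℕ.+ neg π

subsetsOf : {A : Set} → ℕ → List A → List (List A)
subsetsOf zero    xs       = [] ∷ []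
subsetsOf (suc k) []       = []
subsetsOf (suc k) (x ∷ xs) = map (x ∷_) (subsetsOf k xs) ++ subsetsOf (suc k) xs

desFrom : List ℤ → ℕ → ℕ
desFrom π j = length (filterᵇ (λ i → does (j ℕ.≤? i)) (DesB π))

fmajStar : List ℤ → List ℕ → ℤ
fmajStar π S =
  + fmaj π ℤ.- foldr ℤ._+_ (+ 0)
      (map (λ j → + (2 ℕ.* desFrom π j) ℤ.- + 1) S)

B : ℕ → ℕ → ℚ → ℚ
B n k q = sumℚ (map (λ π → q ^ℕ fmaj π)
                    (filterᵇ (λ π → does (desB π ℕ.≟ k)) (signedPerms n)))

-- B^{fmaj}_{n,k}(q) = Σ_{(π,S) ∈ 𝓑^>_{n,k}} q^{fmaj((π,S))}
Bfmaj : ℕ → ℕ → ℚ → ℚ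
Bfmaj n k q = sumℚ (concatMap (λ π → map (λ S → q ^ℤ fmajStar π S)
                                         (subsetsOf k (DesB π)))
                              (signedPerms n))

-- Fix π with d descents. The descent that is i-th from the right in Des_B(π) has
-- |Des_B(π) ∩ {j,…,n-1}| = i, so starring a set of descents with ranks I ⊆ {1,…,d} lowers fmaj
-- by Σ_{i∈I} (2i-1). Summing over the m-element I, the q-Pascal recurrence in d gives
-- q^{fmaj π} q^{m²-2dm} [d m]_{q²}. Grouping the signed permutations by d = n-l, the terms with
-- d < n-k vanish, and the exponent (n-k)(2l-n-k) is m²-2dm for m = n-k.
module Submission where

module _ where
  open import Defs
  open import Data.Nat as ℕ using (ℕ; zero; suc; _∸_; _≤_; _<_)
  import Data.Nat.Properties as ℕ
  open import Data.Integer as ℤ using (ℤ; +_; -[1+_])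
  import Data.Integer.Properties as ℤ
  open import Data.Rational as ℚ using (ℚ; 0ℚ; 1ℚ; _+_; _*_; 1/_; ≢-nonZero)
  import Data.Rational.Properties as ℚ
  open import Data.Rational.Solver using (module +-*-Solver)
  open +-*-Solver using (solve; _:+_; _:*_; _:=_)
  open import Data.Integer.Tactic.RingSolver using (solve-∀)
  open import Data.List using (List; []; _∷_; _++_; map; concatMap; filterᵇ; upTo; applyUpTo; length; foldr)
  open import Data.Product using (_×_; _,_)
  open import Data.Unit using (⊤)
  import Data.List.Properties as List
  open import Data.List.Relation.Unary.All as All using (All; []; _∷_)
  import Data.List.Relation.Unary.All.Properties as AllP
  open import Data.List.Relation.Unary.AllPairs using (AllPairs; []; _∷_)
  open import Data.Bool using (Bool; true; false; if_then_else_)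
  open import Function using (_∘_; id)
  open import Relation.Nullary using (does; yes; no; contradiction)
  open import Relation.Nullary.Decidable using (T?; dec-true; dec-false)
  open import Relation.Binary.Definitions using (tri<; tri≈; tri>)
  open import Relation.Binary.PropositionalEquality
  open ≡-Reasoning

  ÷'-≡-*1/ : ∀ a b (b≢0 : b ≢ 0ℚ) → a ÷' b ≡ a * (1/ b) {{≢-nonZero b≢0}}
  ÷'-≡-*1/ a b b≢0 with b ℚ.≟ 0ℚ
  ... | yes b≡0 = contradiction b≡0 b≢0
  ... | no _    = refl

  ÷'-cancelʳ : ∀ a b → b ≢ 0ℚ → (a * b) ÷' b ≡ a
  ÷'-cancelʳ a b b≢0 = begin
    (a * b) ÷' b       ≡⟨ ÷'-≡-*1/ (a * b) b b≢0 ⟩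
    (a * b) * (1/ b)   ≡⟨ ℚ.*-assoc a b (1/ b) ⟩
    a * (b * (1/ b))   ≡⟨ cong (a *_) (ℚ.*-inverseʳ b) ⟩
    a * 1ℚ             ≡⟨ ℚ.*-identityʳ a ⟩
    a                  ∎
    where instance _ = ≢-nonZero b≢0

  ÷'-inverseˡ : ∀ b → b ≢ 0ℚ → (1ℚ ÷' b) * b ≡ 1ℚ
  ÷'-inverseˡ b b≢0 = begin
    (1ℚ ÷' b) * b      ≡⟨ cong (_* b) (÷'-≡-*1/ 1ℚ b b≢0) ⟩
    (1ℚ * 1/ b) * b    ≡⟨ cong (_* b) (ℚ.*-identityˡ (1/ b)) ⟩
    1/ b * b           ≡⟨ ℚ.*-inverseˡ b ⟩
    1ℚ                 ∎
    where instance _ = ≢-nonZero b≢0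

  inverse-unique : ∀ a b → b ≢ 0ℚ → a * b ≡ 1ℚ → a ≡ 1ℚ ÷' b
  inverse-unique a b b≢0 ab≡1 = begin
    a               ≡⟨ ÷'-cancelʳ a b b≢0 ⟨
    (a * b) ÷' b    ≡⟨ cong (_÷' b) ab≡1 ⟩
    1ℚ ÷' b         ∎

  *-≢0 : ∀ {a b} → a ≢ 0ℚ → b ≢ 0ℚ → a * b ≢ 0ℚ
  *-≢0 {a} {b} a≢0 b≢0 ab≡0 = b≢0 (begin
    b                     ≡⟨ ℚ.*-identityˡ b ⟨
    1ℚ * b                ≡⟨ cong (_* b) (÷'-inverseˡ a a≢0) ⟨
    ((1ℚ ÷' a) * a) * b   ≡⟨ ℚ.*-assoc (1ℚ ÷' a) a b ⟩
    (1ℚ ÷' a) * (a * b)   ≡⟨ cong ((1ℚ ÷' a) *_) ab≡0 ⟩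
    (1ℚ ÷' a) * 0ℚ        ≡⟨ ℚ.*-zeroʳ (1ℚ ÷' a) ⟩
    0ℚ                    ∎)

  ^ℕ-≢0 : ∀ {q} → q ≢ 0ℚ → ∀ n → q ^ℕ n ≢ 0ℚ
  ^ℕ-≢0 q≢0 zero    = λ ()
  ^ℕ-≢0 q≢0 (suc n) = *-≢0 q≢0 (^ℕ-≢0 q≢0 n)

  ^ℕ-double : ∀ q k → q ^ℕ (2 ℕ.* k) ≡ (q * q) ^ℕ k
  ^ℕ-double q zero    = refl
  ^ℕ-double q (suc k) = begin
    q ^ℕ (2 ℕ.* suc k)           ≡⟨ cong (q ^ℕ_) (ℕ.*-suc 2 k) ⟩
    q * (q * q ^ℕ (2 ℕ.* k))     ≡⟨ ℚ.*-assoc q q _ ⟨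
    (q * q) * q ^ℕ (2 ℕ.* k)     ≡⟨ cong ((q * q) *_) (^ℕ-double q k) ⟩
    (q * q) * (q * q) ^ℕ k       ∎

  module _ {q : ℚ} (q≢0 : q ≢ 0ℚ) where

    ^ℤ-suc : ∀ z → q ^ℤ (z ℤ.+ + 1) ≡ q ^ℤ z * q
    ^ℤ-suc (+ n)        = trans (cong (q ^ℕ_) (ℕ.+-comm n 1)) (ℚ.*-comm q (q ^ℕ n))
    ^ℤ-suc -[1+ zero ]  = sym (begin
      (1ℚ ÷' (q * 1ℚ)) * q          ≡⟨ cong (λ r → (1ℚ ÷' r) * q) (ℚ.*-identityʳ q) ⟩
      (1ℚ ÷' q) * q                 ≡⟨ ÷'-inverseˡ q q≢0 ⟩
      1ℚ                            ∎)
    ^ℤ-suc -[1+ suc n ] = sym (inverse-unique _ _ (^ℕ-≢0 q≢0 (suc n)) (begin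
      ((1ℚ ÷' (q ^ℕ suc (suc n))) * q) * q ^ℕ suc n   ≡⟨ ℚ.*-assoc (1ℚ ÷' (q ^ℕ suc (suc n))) q (q ^ℕ suc n) ⟩
      (1ℚ ÷' (q ^ℕ suc (suc n))) * q ^ℕ suc (suc n)   ≡⟨ ÷'-inverseˡ _ (^ℕ-≢0 q≢0 (suc (suc n))) ⟩
      1ℚ                                              ∎))

    ^ℤ-+ℕ : ∀ z n → q ^ℤ (z ℤ.+ + n) ≡ q ^ℤ z * q ^ℕ n
    ^ℤ-+ℕ z zero    = trans (cong (q ^ℤ_) (ℤ.+-identityʳ z)) (sym (ℚ.*-identityʳ (q ^ℤ z)))
    ^ℤ-+ℕ z (suc n) = begin
      q ^ℤ (z ℤ.+ + suc n)         ≡⟨ cong (q ^ℤ_) (ℤ.+-assoc z (+ 1) (+ n)) ⟨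
      q ^ℤ (z ℤ.+ + 1 ℤ.+ + n)     ≡⟨ ^ℤ-+ℕ (z ℤ.+ + 1) n ⟩
      q ^ℤ (z ℤ.+ + 1) * q ^ℕ n    ≡⟨ cong (_* q ^ℕ n) (^ℤ-suc z) ⟩
      (q ^ℤ z * q) * q ^ℕ n        ≡⟨ ℚ.*-assoc (q ^ℤ z) q (q ^ℕ n) ⟩
      q ^ℤ z * q ^ℕ suc n          ∎

    ^ℤ-+ : ∀ z w → q ^ℤ (z ℤ.+ w) ≡ q ^ℤ z * q ^ℤ w
    ^ℤ-+ z (+ n)      = ^ℤ-+ℕ z n
    ^ℤ-+ z -[1+ n ]   = begin
      r                            ≡⟨ ℚ.*-identityʳ r ⟨
      r * 1ℚ                       ≡⟨ cong (r *_) (÷'-inverseˡ (q ^ℕ suc n) (^ℕ-≢0 q≢0 (suc n))) ⟨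
      r * (u * q ^ℕ suc n)         ≡⟨ regroup r u (q ^ℕ suc n) ⟩
      (r * q ^ℕ suc n) * u         ≡⟨ cong (_* u) (^ℤ-+ℕ (z ℤ.+ -[1+ n ]) (suc n)) ⟨
      q ^ℤ (z ℤ.+ -[1+ n ] ℤ.+ + suc n) * u
                                   ≡⟨ cong (λ t → q ^ℤ t * u) (minus-plus z (+ suc n)) ⟩
      q ^ℤ z * u                   ∎
      where
      r = q ^ℤ (z ℤ.+ -[1+ n ])
      u = q ^ℤ -[1+ n ]
      regroup : ∀ a b c → a * (b * c) ≡ (a * c) * b
      regroup = solve 3 (λ a b c → a :* (b :* c) := (a :* c) :* b) refl
      minus-plus : ∀ z w → z ℤ.+ ℤ.- w ℤ.+ w ≡ z
      minus-plus = solve-∀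

  sum-++ : ∀ xs ys → sumℚ (xs ++ ys) ≡ sumℚ xs + sumℚ ys
  sum-++ []       ys = sym (ℚ.+-identityˡ (sumℚ ys))
  sum-++ (x ∷ xs) ys = trans (cong (_+_ x) (sum-++ xs ys)) (sym (ℚ.+-assoc x (sumℚ xs) (sumℚ ys)))

  module _ {A : Set} where

    sum-concatMap : ∀ (f : A → List ℚ) xs → sumℚ (concatMap f xs) ≡ sumℚ (map (sumℚ ∘ f) xs)
    sum-concatMap f []       = refl
    sum-concatMap f (x ∷ xs) = trans (sum-++ (f x) (concatMap f xs)) (cong (_+_ (sumℚ (f x))) (sum-concatMap f xs))

    sum-cong-local : ∀ {f g : A → ℚ} {xs} → All (λ a → f a ≡ g a) xs → sumℚ (map f xs) ≡ sumℚ (map g xs)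
    sum-cong-local = cong sumℚ ∘ List.map-cong-local

    sum-cong : ∀ {f g : A → ℚ} → (∀ a → f a ≡ g a) → ∀ xs → sumℚ (map f xs) ≡ sumℚ (map g xs)
    sum-cong f≗g xs = cong sumℚ (List.map-cong f≗g xs)

    *-distribˡ-sum : ∀ c (f : A → ℚ) xs → sumℚ (map (λ a → c * f a) xs) ≡ c * sumℚ (map f xs)
    *-distribˡ-sum c f []       = sym (ℚ.*-zeroʳ c)
    *-distribˡ-sum c f (x ∷ xs) =
      trans (cong (_+_ (c * f x)) (*-distribˡ-sum c f xs)) (sym (ℚ.*-distribˡ-+ c (f x) _))

    sum-zero : ∀ (xs : List A) → sumℚ (map (λ _ → 0ℚ) xs) ≡ 0ℚ
    sum-zero []       = refl
    sum-zero (x ∷ xs) = trans (ℚ.+-identityˡ _) (sum-zero xs)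

    sum-+ : ∀ (f g : A → ℚ) xs → sumℚ (map (λ a → f a + g a) xs) ≡ sumℚ (map f xs) + sumℚ (map g xs)
    sum-+ f g []       = sym (ℚ.+-identityˡ 0ℚ)
    sum-+ f g (x ∷ xs) = trans (cong (_+_ (f x + g x)) (sum-+ f g xs)) (interchange (f x) (g x) _ _)
      where
      interchange : ∀ a b c d → a + b + (c + d) ≡ a + c + (b + d)
      interchange = solve 4 (λ a b c d → a :+ b :+ (c :+ d) := a :+ c :+ (b :+ d)) refl

    sum-filterᵇ-* : ∀ (p : A → Bool) (f : A → ℚ) c xs →
      sumℚ (map f (filterᵇ p xs)) * c ≡ sumℚ (map (λ a → if p a then f a * c else 0ℚ) xs)
    sum-filterᵇ-* p f c []       = ℚ.*-zeroˡ c
    sum-filterᵇ-* p f c (x ∷ xs) with p x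
    ... | true  = trans (ℚ.*-distribʳ-+ c (f x) _) (cong (_+_ (f x * c)) (sum-filterᵇ-* p f c xs))
    ... | false = trans (sum-filterᵇ-* p f c xs) (sym (ℚ.+-identityˡ _))

  sum-swap : ∀ {A C : Set} (h : C → A → ℚ) cs xs →
    sumℚ (map (λ c → sumℚ (map (h c) xs)) cs) ≡ sumℚ (map (λ x → sumℚ (map (λ c → h c x) cs)) xs)
  sum-swap h []       xs = sym (sum-zero xs)
  sum-swap h (c ∷ cs) xs = begin
    sumℚ (map (h c) xs) + sumℚ (map (λ c′ → sumℚ (map (h c′) xs)) cs)
      ≡⟨ cong (_+_ (sumℚ (map (h c) xs))) (sum-swap h cs xs) ⟩
    sumℚ (map (h c) xs) + sumℚ (map (λ x → sumℚ (map (λ c′ → h c′ x) cs)) xs)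
      ≡⟨ sum-+ (h c) (λ x → sumℚ (map (λ c′ → h c′ x) cs)) xs ⟨
    sumℚ (map (λ x → h c x + sumℚ (map (λ c′ → h c′ x) cs)) xs) ∎

  sum-upTo-δ : ∀ K j c →
    sumℚ (map (λ l → if does (l ℕ.≟ j) then c else 0ℚ) (upTo K)) ≡ (if does (j ℕ.<? K) then c else 0ℚ)
  sum-upTo-δ zero    j c = refl
  sum-upTo-δ (suc K) j c = begin
    sumℚ (map δ (upTo (suc K)))               ≡⟨ cong (sumℚ ∘ map δ) (List.upTo-∷ʳ K) ⟨
    sumℚ (map δ (upTo K ++ K ∷ []))           ≡⟨ cong sumℚ (List.map-++ δ (upTo K) (K ∷ [])) ⟩
    sumℚ (map δ (upTo K) ++ δ K ∷ [])         ≡⟨ sum-++ (map δ (upTo K)) (δ K ∷ []) ⟩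
    sumℚ (map δ (upTo K)) + (δ K + 0ℚ)        ≡⟨ cong₂ _+_ (sum-upTo-δ K j c) (ℚ.+-identityʳ (δ K)) ⟩
    (if does (j ℕ.<? K) then c else 0ℚ) + δ K ≡⟨ last ⟩
    (if does (j ℕ.<? suc K) then c else 0ℚ)   ∎
    where
    δ : ℕ → ℚ
    δ l = if does (l ℕ.≟ j) then c else 0ℚ
    last : (if does (j ℕ.<? K) then c else 0ℚ) + δ K ≡ (if does (j ℕ.<? suc K) then c else 0ℚ)
    last with ℕ.<-cmp j K
    ... | tri< j<K j≢K _
          rewrite dec-true (j ℕ.<? K) j<K | dec-false (K ℕ.≟ j) (j≢K ∘ sym)
                | dec-true (j ℕ.<? suc K) (ℕ.m<n⇒m<1+n j<K) = ℚ.+-identityʳ c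
    ... | tri≈ _ refl _
          rewrite dec-false (j ℕ.<? j) (ℕ.<-irrefl refl) | dec-true (j ℕ.≟ j) refl
                | dec-true (j ℕ.<? suc j) (ℕ.n<1+n j) = ℚ.+-identityˡ c
    ... | tri> _ j≢K K<j
          rewrite dec-false (j ℕ.<? K) (ℕ.<-asym K<j) | dec-false (K ℕ.≟ j) (j≢K ∘ sym)
                | dec-false (j ℕ.<? suc K) (ℕ.<⇒≱ K<j ∘ ℕ.≤-pred) = ℚ.+-identityʳ 0ℚ

  qInt-suc : ∀ k x → qInt (suc k) x ≡ 1ℚ + x * qInt k x
  qInt-suc k x = cong (_+_ 1ℚ) (begin
    sumℚ (map (x ^ℕ_) (applyUpTo suc k))        ≡⟨ cong sumℚ (List.map-applyUpTo suc (x ^ℕ_) k) ⟩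
    sumℚ (applyUpTo (λ i → x * x ^ℕ i) k)       ≡⟨ cong sumℚ (List.map-applyUpTo id (λ i → x * x ^ℕ i) k) ⟨
    sumℚ (map (λ i → x * x ^ℕ i) (upTo k))      ≡⟨ *-distribˡ-sum x (x ^ℕ_) (upTo k) ⟩
    x * qInt k x                                ∎)

  qInt-+ : ∀ a b x → qInt (a ℕ.+ b) x ≡ qInt a x + x ^ℕ a * qInt b x
  qInt-+ zero    b x = sym (trans (ℚ.+-identityˡ _) (ℚ.*-identityˡ _))
  qInt-+ (suc a) b x = begin
    qInt (suc (a ℕ.+ b)) x                        ≡⟨ qInt-suc (a ℕ.+ b) x ⟩
    1ℚ + x * qInt (a ℕ.+ b) x                     ≡⟨ cong (λ t → 1ℚ + x * t) (qInt-+ a b x) ⟩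
    1ℚ + x * (qInt a x + x ^ℕ a * qInt b x)       ≡⟨ regroup 1ℚ x (qInt a x) (x ^ℕ a) (qInt b x) ⟩
    (1ℚ + x * qInt a x) + x ^ℕ suc a * qInt b x   ≡⟨ cong (_+ x ^ℕ suc a * qInt b x) (qInt-suc a x) ⟨
    qInt (suc a) x + x ^ℕ suc a * qInt b x        ∎
    where
    regroup : ∀ o x i p j → o + x * (i + p * j) ≡ (o + x * i) + (x * p) * j
    regroup = solve 5 (λ o x i p j → o :+ x :* (i :+ p :* j) := (o :+ x :* i) :+ (x :* p) :* j) refl

  -- The q-binomial by the q-Pascal rule, free of the division in qBinom.
  gaussian : ℕ → ℕ → ℚ → ℚ
  gaussian d       zero    x = 1ℚ
  gaussian zero    (suc m) x = 0ℚ
  gaussian (suc d) (suc m) x = gaussian d m x + x ^ℕ suc m * gaussian d (suc m) x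

  gaussian-vanish : ∀ {d m} x → d < m → gaussian d m x ≡ 0ℚ
  gaussian-vanish {zero}  {suc m} x _ = refl
  gaussian-vanish {suc d} {suc m} x (ℕ.s≤s d<m) = begin
    gaussian d m x + x ^ℕ suc m * gaussian d (suc m) x
      ≡⟨ cong₂ (λ a b → a + x ^ℕ suc m * b) (gaussian-vanish x d<m) (gaussian-vanish x (ℕ.m<n⇒m<1+n d<m)) ⟩
    0ℚ + x ^ℕ suc m * 0ℚ   ≡⟨ trans (ℚ.+-identityˡ _) (ℚ.*-zeroʳ (x ^ℕ suc m)) ⟩
    0ℚ                     ∎

  gaussian-diagonal : ∀ m x → gaussian m m x ≡ 1ℚ
  gaussian-diagonal zero    x = refl
  gaussian-diagonal (suc m) x = begin
    gaussian m m x + x ^ℕ suc m * gaussian m (suc m) x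
      ≡⟨ cong₂ (λ a b → a + x ^ℕ suc m * b) (gaussian-diagonal m x) (gaussian-vanish x (ℕ.n<1+n m)) ⟩
    1ℚ + x ^ℕ suc m * 0ℚ   ≡⟨ trans (cong (_+_ 1ℚ) (ℚ.*-zeroʳ (x ^ℕ suc m))) (ℚ.+-identityʳ 1ℚ) ⟩
    1ℚ                     ∎

  gaussian-qFact : ∀ m r x → gaussian (m ℕ.+ r) m x * (qFact m x * qFact r x) ≡ qFact (m ℕ.+ r) x
  gaussian-qFact zero    r       x = trans (ℚ.*-identityˡ (1ℚ * qFact r x)) (ℚ.*-identityˡ (qFact r x))
  gaussian-qFact (suc m) zero    x rewrite ℕ.+-identityʳ m = begin
    gaussian (suc m) (suc m) x * (qFact (suc m) x * 1ℚ)   ≡⟨ cong₂ _*_ (gaussian-diagonal (suc m) x) (ℚ.*-identityʳ (qFact (suc m) x)) ⟩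
    1ℚ * qFact (suc m) x                                  ≡⟨ ℚ.*-identityˡ (qFact (suc m) x) ⟩
    qFact (suc m) x                                       ∎
  gaussian-qFact (suc m) (suc r) x = begin
    (A + P * C) * ((Im * Fm) * (Ir * Fr))                 ≡⟨ regroup A P C Im Fm Ir Fr ⟩
    Im * (A * (Fm * (Ir * Fr))) + (P * Ir) * (C * ((Im * Fm) * Fr))
                                                          ≡⟨ cong₂ (λ s t → Im * s + (P * Ir) * t) (gaussian-qFact m (suc r) x) shifted ⟩
    Im * Fd + (P * Ir) * Fd                               ≡⟨ ℚ.*-distribʳ-+ Fd Im (P * Ir) ⟨
    (Im + P * Ir) * Fd                                    ≡⟨ cong (_* Fd) (qInt-+ (suc m) (suc r) x) ⟨
    qFact (suc (m ℕ.+ suc r)) x                           ∎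
    where
    A  = gaussian (m ℕ.+ suc r) m x
    C  = gaussian (m ℕ.+ suc r) (suc m) x
    P  = x ^ℕ suc m
    Im = qInt (suc m) x
    Ir = qInt (suc r) x
    Fm = qFact m x
    Fr = qFact r x
    Fd = qFact (m ℕ.+ suc r) x
    shifted : C * ((Im * Fm) * Fr) ≡ Fd
    shifted rewrite ℕ.+-suc m r = gaussian-qFact (suc m) r x
    regroup : ∀ a p c i f j g →
      (a + p * c) * ((i * f) * (j * g)) ≡ i * (a * (f * (j * g))) + (p * j) * (c * ((i * f) * g))
    regroup = solve 7 (λ a p c i f j g → (a :+ p :* c) :* ((i :* f) :* (j :* g))
                                     := i :* (a :* (f :* (j :* g))) :+ (p :* j) :* (c :* ((i :* f) :* g))) refl

  module _ (x : ℚ) .{{x≥0 : ℚ.NonNegative x}} where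

    qInt-suc-positive : ∀ k → ℚ.Positive (qInt (suc k) x)
    qInt-suc-positive k = subst ℚ.Positive (sym (qInt-suc k x)) (ℚ.pos+nonNeg⇒pos 1ℚ (x * qInt k x) {{x*qInt≥0 k}})
      where
      x*qInt≥0 : ∀ k → ℚ.NonNegative (x * qInt k x)
      x*qInt≥0 zero    = subst ℚ.NonNegative (sym (ℚ.*-zeroʳ x)) _
      x*qInt≥0 (suc k) =
        ℚ.nonNeg*nonNeg⇒nonNeg x (qInt (suc k) x) {{ℚ.pos⇒nonNeg (qInt (suc k) x) {{qInt-suc-positive k}}}}

    qFact-≢0 : ∀ k → qFact k x ≢ 0ℚ
    qFact-≢0 zero    = λ ()
    qFact-≢0 (suc k) = *-≢0 {qInt (suc k) x} (positive⇒≢0 (qInt-suc-positive k)) (qFact-≢0 k)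
      where
      positive⇒≢0 : ∀ {p} → ℚ.Positive p → p ≢ 0ℚ
      positive⇒≢0 {p} p>0 p≡0 = ℚ.<-irrefl (sym p≡0) (ℚ.positive⁻¹ p {{p>0}})

    qBinom≡gaussian : ∀ m r → qBinom (m ℕ.+ r) r x ≡ gaussian (m ℕ.+ r) m x
    qBinom≡gaussian m r = begin
      qFact (m ℕ.+ r) x ÷' (Fr * qFact (m ℕ.+ r ∸ r) x)   ≡⟨ cong (λ t → qFact (m ℕ.+ r) x ÷' (Fr * qFact t x)) (ℕ.m+n∸n≡m m r) ⟩
      qFact (m ℕ.+ r) x ÷' (Fr * Fm)                       ≡⟨ cong (_÷' (Fr * Fm)) (gaussian-qFact m r x) ⟨
      (G * (Fm * Fr)) ÷' (Fr * Fm)                         ≡⟨ cong (λ t → (G * t) ÷' (Fr * Fm)) (ℚ.*-comm Fm Fr) ⟩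
      (G * (Fr * Fm)) ÷' (Fr * Fm)                         ≡⟨ ÷'-cancelʳ G (Fr * Fm) (*-≢0 (qFact-≢0 r) (qFact-≢0 m)) ⟩
      G                                                    ∎
      where
      G  = gaussian (m ℕ.+ r) m x
      Fm = qFact m x
      Fr = qFact r x

  square-nonNegative : ∀ q → ℚ.NonNegative (q * q)
  square-nonNegative q with ℚ.<-cmp q 0ℚ
  ... | tri< q<0 _ _ = ℚ.pos⇒nonNeg (q * q) {{ℚ.neg*neg⇒pos q {{ℚ.negative q<0}} q {{ℚ.negative q<0}}}}
  ... | tri≈ _ refl _ = _
  ... | tri> _ _ q>0 = ℚ.pos⇒nonNeg (q * q) {{ℚ.pos*pos⇒pos q {{ℚ.positive q>0}} q {{ℚ.positive q>0}}}}

  -- fmajStar π S is definitionally + fmaj π ℤ.- starWeight (desFrom π) S.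
  starWeight : (ℕ → ℕ) → List ℕ → ℤ
  starWeight w S = foldr ℤ._+_ (+ 0) (map (λ j → + (2 ℕ.* w j) ℤ.- + 1) S)

  RanksFromEnd : (ℕ → ℕ) → List ℕ → Set
  RanksFromEnd w []       = ⊤
  RanksFromEnd w (x ∷ xs) = w x ≡ suc (length xs) × RanksFromEnd w xs

  starExponent : ℕ → ℕ → ℤ
  starExponent d m = + m ℤ.* + m ℤ.- + 2 ℤ.* + m ℤ.* + d

  starFactor : ℚ → ℕ → ℕ → ℚ
  starFactor q d m = q ^ℤ starExponent d m * gaussian d m (q * q)

  starredSubsetSum : ℚ → (ℕ → ℕ) → List ℕ → ℕ → ℚ
  starredSubsetSum q w L m = sumℚ (map (λ S → q ^ℤ (ℤ.- starWeight w S)) (subsetsOf m L))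

  starExponent-star : ∀ d m → ℤ.- (+ (2 ℕ.* suc d) ℤ.- + 1) ℤ.+ starExponent d m ≡ starExponent (suc d) (suc m)
  starExponent-star d m rewrite ℤ.pos-* 2 (suc d) = ring (+ m) (+ d)
    where
    ring : ∀ m d → ℤ.- (+ 2 ℤ.* (+ 1 ℤ.+ d) ℤ.- + 1) ℤ.+ (m ℤ.* m ℤ.- + 2 ℤ.* m ℤ.* d)
                   ≡ (+ 1 ℤ.+ m) ℤ.* (+ 1 ℤ.+ m) ℤ.- + 2 ℤ.* (+ 1 ℤ.+ m) ℤ.* (+ 1 ℤ.+ d)
    ring = solve-∀

  starExponent-skip : ∀ d m → starExponent d (suc m) ≡ starExponent (suc d) (suc m) ℤ.+ + (2 ℕ.* suc m)
  starExponent-skip d m rewrite ℤ.pos-* 2 (suc m) = ring (+ suc m) (+ d)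
    where
    ring : ∀ s d → s ℤ.* s ℤ.- + 2 ℤ.* s ℤ.* d ≡ (s ℤ.* s ℤ.- + 2 ℤ.* s ℤ.* (+ 1 ℤ.+ d)) ℤ.+ + 2 ℤ.* s
    ring = solve-∀

  module _ {q : ℚ} (q≢0 : q ≢ 0ℚ) where

    starredSubsetSum-∷ : ∀ w x xs m →
      starredSubsetSum q w (x ∷ xs) (suc m)
        ≡ q ^ℤ (ℤ.- (+ (2 ℕ.* w x) ℤ.- + 1)) * starredSubsetSum q w xs m + starredSubsetSum q w xs (suc m)
    starredSubsetSum-∷ w x xs m = begin
      sumℚ (map f (map (x ∷_) with-x ++ without-x))
        ≡⟨ cong sumℚ (List.map-++ f (map (x ∷_) with-x) without-x) ⟩
      sumℚ (map f (map (x ∷_) with-x) ++ map f without-x)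
        ≡⟨ sum-++ (map f (map (x ∷_) with-x)) (map f without-x) ⟩
      sumℚ (map f (map (x ∷_) with-x)) + starredSubsetSum q w xs (suc m)
        ≡⟨ cong (λ t → sumℚ t + starredSubsetSum q w xs (suc m)) (List.map-∘ with-x) ⟨
      sumℚ (map (f ∘ (x ∷_)) with-x) + starredSubsetSum q w xs (suc m)
        ≡⟨ cong (_+ starredSubsetSum q w xs (suc m)) (sum-cong f-∷ with-x) ⟩
      sumℚ (map (λ S → c * f S) with-x) + starredSubsetSum q w xs (suc m)
        ≡⟨ cong (_+ starredSubsetSum q w xs (suc m)) (*-distribˡ-sum c f with-x) ⟩
      c * starredSubsetSum q w xs m + starredSubsetSum q w xs (suc m) ∎
      where
      f : List ℕ → ℚ
      f S = q ^ℤ (ℤ.- starWeight w S)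
      with-x    = subsetsOf m xs
      without-x = subsetsOf (suc m) xs
      e = + (2 ℕ.* w x) ℤ.- + 1
      c = q ^ℤ (ℤ.- e)
      f-∷ : ∀ S → f (x ∷ S) ≡ c * f S
      f-∷ S = trans (cong (q ^ℤ_) (ℤ.neg-distrib-+ e (starWeight w S))) (^ℤ-+ q≢0 (ℤ.- e) (ℤ.- starWeight w S))

    starredSubsetSum≡starFactor : ∀ {w} L → RanksFromEnd w L → ∀ m →
      starredSubsetSum q w L m ≡ starFactor q (length L) m
    starredSubsetSum≡starFactor L _ zero = trans (ℚ.+-identityʳ 1ℚ) (sym (ℚ.*-identityʳ 1ℚ))
    starredSubsetSum≡starFactor [] _ (suc m) = sym (ℚ.*-zeroʳ (q ^ℤ starExponent 0 (suc m)))
    starredSubsetSum≡starFactor {w} (x ∷ xs) (wx≡ , ranks) (suc m) = begin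
      starredSubsetSum q w (x ∷ xs) (suc m)
        ≡⟨ starredSubsetSum-∷ w x xs m ⟩
      c * starredSubsetSum q w xs m + starredSubsetSum q w xs (suc m)
        ≡⟨ cong₂ (λ a b → c * a + b) (starredSubsetSum≡starFactor xs ranks m) (starredSubsetSum≡starFactor xs ranks (suc m)) ⟩
      c * (q ^ℤ starExponent d m * G) + q ^ℤ starExponent d (suc m) * G′
        ≡⟨ cong₂ (λ a b → a + q ^ℤ b * G′) (sym (ℚ.*-assoc c (q ^ℤ starExponent d m) G)) (starExponent-skip d m) ⟩
      (c * q ^ℤ starExponent d m) * G + q ^ℤ (E ℤ.+ + (2 ℕ.* suc m)) * G′
        ≡⟨ cong₂ (λ a b → a * G + b * G′) (sym (^ℤ-+ q≢0 e (starExponent d m))) (^ℤ-+ q≢0 E (+ (2 ℕ.* suc m))) ⟩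
      q ^ℤ (e ℤ.+ starExponent d m) * G + (q ^ℤ E * q ^ℕ (2 ℕ.* suc m)) * G′
        ≡⟨ cong₂ (λ a b → q ^ℤ a * G + (q ^ℤ E * b) * G′) exponent (^ℕ-double q (suc m)) ⟩
      q ^ℤ E * G + (q ^ℤ E * (q * q) ^ℕ suc m) * G′
        ≡⟨ factor (q ^ℤ E) G ((q * q) ^ℕ suc m) G′ ⟩
      q ^ℤ E * (G + (q * q) ^ℕ suc m * G′) ∎
      where
      d  = length xs
      e  = ℤ.- (+ (2 ℕ.* w x) ℤ.- + 1)
      c  = q ^ℤ e
      E  = starExponent (suc d) (suc m)
      G  = gaussian d m (q * q)
      G′ = gaussian d (suc m) (q * q)
      exponent : e ℤ.+ starExponent d m ≡ E
      exponent = trans (cong (λ r → ℤ.- (+ (2 ℕ.* r) ℤ.- + 1) ℤ.+ starExponent d m) wx≡) (starExponent-star d m)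
      factor : ∀ a b p s → a * b + (a * p) * s ≡ a * (b + p * s)
      factor = solve 4 (λ a b p s → a :* b :+ (a :* p) :* s := a :* (b :+ p :* s)) refl

  RanksFromEnd-cong : ∀ {w w′} L → All (λ j → w j ≡ w′ j) L → RanksFromEnd w L → RanksFromEnd w′ L
  RanksFromEnd-cong []       []           _             = _
  RanksFromEnd-cong (x ∷ xs) (wx≡ ∷ w≗w′) (rank , ranks) = trans (sym wx≡) rank , RanksFromEnd-cong xs w≗w′ ranks

  countFrom : ℕ → List ℕ → ℕ
  countFrom j D = length (filterᵇ (λ i → does (j ℕ.≤? i)) D)

  countFrom-all : ∀ {j D} → All (j ≤_) D → countFrom j D ≡ length D
  countFrom-all {j} j≤D = cong length (List.filter-all (T? ∘ (λ i → does (j ℕ.≤? i))) (All.map ℕ.≤⇒≤ᵇ j≤D))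

  countFrom-skip : ∀ {j y} D → y < j → countFrom j (y ∷ D) ≡ countFrom j D
  countFrom-skip {j} {y} D y<j = cong length (List.filter-reject (T? ∘ (λ i → does (j ℕ.≤? i))) (ℕ.<⇒≱ y<j ∘ ℕ.≤ᵇ⇒≤ j y))

  countFrom-ranks : ∀ {D} → AllPairs _<_ D → RanksFromEnd (λ j → countFrom j D) D
  countFrom-ranks []                    = _
  countFrom-ranks {y ∷ ys} (y<ys ∷ inc) =
      countFrom-all (ℕ.≤-refl ∷ All.map ℕ.<⇒≤ y<ys)
    , RanksFromEnd-cong ys (All.map (λ y<j → sym (countFrom-skip ys y<j)) y<ys) (countFrom-ranks inc)

  desGo-≥ : ∀ i p xs → All (i ≤_) (desGo i p xs)
  desGo-≥ i p []       = []
  desGo-≥ i p (x ∷ xs) with does (x ℤ.<? p)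
  ... | true  = ℕ.≤-refl ∷ All.map ℕ.<⇒≤ (desGo-≥ (suc i) x xs)
  ... | false = All.map ℕ.<⇒≤ (desGo-≥ (suc i) x xs)

  desGo-increasing : ∀ i p xs → AllPairs _<_ (desGo i p xs)
  desGo-increasing i p []       = []
  desGo-increasing i p (x ∷ xs) with does (x ℤ.<? p)
  ... | true  = desGo-≥ (suc i) x xs ∷ desGo-increasing (suc i) x xs
  ... | false = desGo-increasing (suc i) x xs

  desGo-length : ∀ i p xs → length (desGo i p xs) ≤ length xs
  desGo-length i p []       = ℕ.z≤n
  desGo-length i p (x ∷ xs) with does (x ℤ.<? p)
  ... | true  = ℕ.s≤s (desGo-length (suc i) x xs)
  ... | false = ℕ.m≤n⇒m≤1+n (desGo-length (suc i) x xs)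

  desFrom-ranks : ∀ π → RanksFromEnd (desFrom π) (DesB π)
  desFrom-ranks π = countFrom-ranks (desGo-increasing 0 (+ 0) π)

  desB≤length : ∀ π → desB π ≤ length π
  desB≤length = desGo-length 0 (+ 0)

  words-length : ∀ m L → All (λ w → length w ≡ m) (words m L)
  words-length zero    L = refl ∷ []
  words-length (suc m) L =
    AllP.concat⁺ (AllP.map⁺ (All.universal (λ x → AllP.map⁺ (All.map (cong suc) (words-length m L))) L))

  signedPerms-length : ∀ n → All (λ π → length π ≡ n) (signedPerms n)
  signedPerms-length n = AllP.filter⁺ (T? ∘ distinctAbs) (words-length n (signedLetters n))

  δ-∸-flip : ∀ {n d l} → d ≤ n → l ≤ n → (h : ℕ → ℚ) →
    (if does (d ℕ.≟ n ∸ l) then h (n ∸ l) else 0ℚ) ≡ (if does (l ℕ.≟ n ∸ d) then h d else 0ℚ)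
  δ-∸-flip {n} {d} {l} d≤n l≤n h with d ℕ.≟ n ∸ l
  ... | yes d≡n∸l
        rewrite dec-true (d ℕ.≟ n ∸ l) d≡n∸l
              | dec-true (l ℕ.≟ n ∸ d) (trans (sym (ℕ.m∸[m∸n]≡n l≤n)) (cong (n ∸_) (sym d≡n∸l))) = cong h (sym d≡n∸l)
  ... | no d≢n∸l
        rewrite dec-false (d ℕ.≟ n ∸ l) d≢n∸l
              | dec-false (l ℕ.≟ n ∸ d) (λ l≡n∸d → d≢n∸l (trans (sym (ℕ.m∸[m∸n]≡n d≤n)) (cong (n ∸_) (sym l≡n∸d)))) = refl

  sum-B-by-descents : ∀ n K (h : ℕ → ℚ) q → K ≤ suc n →
    sumℚ (map (λ l → B n (n ∸ l) q * h (n ∸ l)) (upTo K))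
      ≡ sumℚ (map (λ π → if does (n ∸ desB π ℕ.<? K) then q ^ℕ fmaj π * h (desB π) else 0ℚ) (signedPerms n))
  sum-B-by-descents n K h q K≤1+n = begin
    sumℚ (map (λ l → B n (n ∸ l) q * h (n ∸ l)) (upTo K))
      ≡⟨ sum-cong (λ l → sum-filterᵇ-* (λ π → does (desB π ℕ.≟ n ∸ l)) f (h (n ∸ l)) P) (upTo K) ⟩
    sumℚ (map (λ l → sumℚ (map (λ π → if does (desB π ℕ.≟ n ∸ l) then f π * h (n ∸ l) else 0ℚ) P)) (upTo K))
      ≡⟨ sum-cong-local (All.map (λ {l} l<K → sum-cong-local (All.map (λ {π} → flip l<K π) (signedPerms-length n)))
                                 (AllP.all-upTo K)) ⟩
    sumℚ (map (λ l → sumℚ (map (δ l) P)) (upTo K))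
      ≡⟨ sum-swap δ (upTo K) P ⟩
    sumℚ (map (λ π → sumℚ (map (λ l → δ l π) (upTo K))) P)
      ≡⟨ sum-cong (λ π → sum-upTo-δ K (n ∸ desB π) (f π * h (desB π))) P ⟩
    sumℚ (map (λ π → if does (n ∸ desB π ℕ.<? K) then f π * h (desB π) else 0ℚ) P) ∎
    where
    P = signedPerms n
    f : List ℤ → ℚ
    f π = q ^ℕ fmaj π
    δ : ℕ → List ℤ → ℚ
    δ l π = if does (l ℕ.≟ n ∸ desB π) then f π * h (desB π) else 0ℚ
    flip : ∀ {l} → l < K → ∀ π → length π ≡ n →
      (if does (desB π ℕ.≟ n ∸ l) then f π * h (n ∸ l) else 0ℚ) ≡ δ l π
    flip l<K π refl = δ-∸-flip (desB≤length π) (ℕ.≤-pred (ℕ.≤-trans l<K K≤1+n)) (λ d → f π * h d)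

  starFactor-vanish : ∀ q {d m} → d < m → starFactor q d m ≡ 0ℚ
  starFactor-vanish q {d} {m} d<m =
    trans (cong (q ^ℤ starExponent d m *_) (gaussian-vanish (q * q) d<m)) (ℚ.*-zeroʳ (q ^ℤ starExponent d m))

  restrict-to-high-descents : ∀ q {n k} d a → k ≤ n →
    (if does (n ∸ d ℕ.<? suc k) then a * starFactor q d (n ∸ k) else 0ℚ) ≡ a * starFactor q d (n ∸ k)
  restrict-to-high-descents q {n} {k} d a k≤n with n ∸ k ℕ.≤? d
  ... | yes n∸k≤d
        rewrite dec-true (n ∸ d ℕ.<? suc k) (ℕ.s≤s (subst (n ∸ d ≤_) (ℕ.m∸[m∸n]≡n k≤n) (ℕ.∸-monoʳ-≤ n n∸k≤d))) = refl
  ... | no n∸k≰d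
        rewrite starFactor-vanish q (ℕ.≰⇒> n∸k≰d) | ℚ.*-zeroʳ a with does (n ∸ d ℕ.<? suc k)
  ...   | true  = refl
  ...   | false = refl

  pos-∸ : ∀ {a b} → b ≤ a → + (a ∸ b) ≡ + a ℤ.- + b
  pos-∸ {a} {b} b≤a = trans (sym (ℤ.⊖-≥ b≤a)) (sym (ℤ.m-n≡m⊖n a b))

  starExponent-∸ : ∀ {n k l} → k ≤ n → l ≤ k →
    + (n ∸ k) ℤ.* (+ (2 ℕ.* l) ℤ.- + n ℤ.- + k) ≡ starExponent (n ∸ l) (n ∸ k)
  starExponent-∸ {n} {k} {l} k≤n l≤k = begin
    + (n ∸ k) ℤ.* (+ (2 ℕ.* l) ℤ.- + n ℤ.- + k)
      ≡⟨ cong₂ (λ a b → a ℤ.* (b ℤ.- + n ℤ.- + k)) (pos-∸ k≤n) (ℤ.pos-* 2 l) ⟩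
    (+ n ℤ.- + k) ℤ.* (+ 2 ℤ.* + l ℤ.- + n ℤ.- + k)
      ≡⟨ ring (+ n) (+ k) (+ l) ⟩
    (+ n ℤ.- + k) ℤ.* (+ n ℤ.- + k) ℤ.- + 2 ℤ.* (+ n ℤ.- + k) ℤ.* (+ n ℤ.- + l)
      ≡⟨ cong₂ (λ a b → a ℤ.* a ℤ.- + 2 ℤ.* a ℤ.* b) (pos-∸ k≤n) (pos-∸ (ℕ.≤-trans l≤k k≤n)) ⟨
    starExponent (n ∸ l) (n ∸ k) ∎
    where
    ring : ∀ n k l → (n ℤ.- k) ℤ.* (+ 2 ℤ.* l ℤ.- n ℤ.- k)
                     ≡ (n ℤ.- k) ℤ.* (n ℤ.- k) ℤ.- + 2 ℤ.* (n ℤ.- k) ℤ.* (n ℤ.- l)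
    ring = solve-∀

  starFactor≡qBinom : ∀ q {n k l} → k ≤ n → l ≤ k →
    starFactor q (n ∸ l) (n ∸ k)
      ≡ q ^ℤ (+ (n ∸ k) ℤ.* (+ (2 ℕ.* l) ℤ.- + n ℤ.- + k)) * qBinom (n ∸ l) (k ∸ l) (q * q)
  starFactor≡qBinom q {n} {k} {l} k≤n l≤k =
    cong₂ (λ e b → q ^ℤ e * b) (sym (starExponent-∸ k≤n l≤k)) (sym binomial)
    where
    n∸k+k∸l : n ∸ k ℕ.+ (k ∸ l) ≡ n ∸ l
    n∸k+k∸l = trans (sym (ℕ.+-∸-assoc (n ∸ k) l≤k)) (cong (_∸ l) (ℕ.m∸n+n≡m k≤n))
    binomial : qBinom (n ∸ l) (k ∸ l) (q * q) ≡ gaussian (n ∸ l) (n ∸ k) (q * q)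
    binomial = subst (λ d → qBinom d (k ∸ l) (q * q) ≡ gaussian d (n ∸ k) (q * q)) n∸k+k∸l
                 (qBinom≡gaussian (q * q) {{square-nonNegative q}} (n ∸ k) (k ∸ l))

  module _ {q : ℚ} (q≢0 : q ≢ 0ℚ) where

    Bfmaj≡sum-starFactor : ∀ n m →
      Bfmaj n m q ≡ sumℚ (map (λ π → q ^ℕ fmaj π * starFactor q (desB π) m) (signedPerms n))
    Bfmaj≡sum-starFactor n m = trans (sum-concatMap starred (signedPerms n)) (sum-cong sum-starred (signedPerms n))
      where
      starred : List ℤ → List ℚ
      starred π = map (λ S → q ^ℤ fmajStar π S) (subsetsOf m (DesB π))
      sum-starred : ∀ π → sumℚ (starred π) ≡ q ^ℕ fmaj π * starFactor q (desB π) m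
      sum-starred π = begin
        sumℚ (starred π)
          ≡⟨ sum-cong (λ S → ^ℤ-+ q≢0 (+ fmaj π) (ℤ.- starWeight (desFrom π) S)) (subsetsOf m (DesB π)) ⟩
        sumℚ (map (λ S → q ^ℕ fmaj π * q ^ℤ (ℤ.- starWeight (desFrom π) S)) (subsetsOf m (DesB π)))
          ≡⟨ *-distribˡ-sum (q ^ℕ fmaj π) (λ S → q ^ℤ (ℤ.- starWeight (desFrom π) S)) (subsetsOf m (DesB π)) ⟩
        q ^ℕ fmaj π * starredSubsetSum q (desFrom π) (DesB π) m
          ≡⟨ cong (q ^ℕ fmaj π *_) (starredSubsetSum≡starFactor q≢0 (DesB π) (desFrom-ranks π) m) ⟩
        q ^ℕ fmaj π * starFactor q (desB π) m ∎

open import Defs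
open import Data.Nat using (ℕ; _≤_; _∸_; suc; _*_)
open import Data.Integer using (+_; _-_)
open import Data.Rational using (ℚ; 0ℚ)
open import Data.List using (map; upTo)
open import Relation.Binary.PropositionalEquality using (_≡_; _≢_)
import Data.Integer as ℤ
import Data.Rational as ℚ

import Data.Nat as ℕ
import Data.Rational.Properties as ℚ
open import Algebra.Bundles using (CommutativeMonoid)
open import Algebra.Properties.CommutativeSemigroup (CommutativeMonoid.commutativeSemigroup ℚ.*-1-commutativeMonoid)
  using (x∙yz≈yx∙z)
import Data.List.Relation.Unary.All as All
open import Data.List.Relation.Unary.All.Properties using (all-upTo)
open import Data.Bool using (if_then_else_)
open import Relation.Nullary using (does)
open import Relation.Binary.PropositionalEquality using (cong; trans; module ≡-Reasoning)
open ≡-Reasoning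

proposition2p4 : (n k : ℕ) → k ≤ n → (q : ℚ) → q ≢ 0ℚ →
  Bfmaj n (n ∸ k) q ≡
    sumℚ (map (λ l → (q ^ℤ ((+ (n ∸ k)) ℤ.* ((+ (2 * l)) - + n - + k)))
                       ℚ.* B n (n ∸ l) q
                       ℚ.* qBinom (n ∸ l) (k ∸ l) (q ℚ.* q))
              (upTo (suc k)))
proposition2p4 n k k≤n q q≢0 = begin
  Bfmaj n m q
    ≡⟨ Bfmaj≡sum-starFactor q≢0 n m ⟩
  sumℚ (map (λ π → q ^ℕ fmaj π ℚ.* starFactor q (desB π) m) (signedPerms n))
    ≡⟨ sum-cong (λ π → restrict-to-high-descents q (desB π) (q ^ℕ fmaj π) k≤n) (signedPerms n) ⟨
  sumℚ (map (λ π → if does (n ∸ desB π ℕ.<? suc k) then q ^ℕ fmaj π ℚ.* starFactor q (desB π) m else 0ℚ)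
            (signedPerms n))
    ≡⟨ sum-B-by-descents n (suc k) (λ d → starFactor q d m) q (ℕ.s≤s k≤n) ⟨
  sumℚ (map (λ l → B n (n ∸ l) q ℚ.* starFactor q (n ∸ l) m) (upTo (suc k)))
    ≡⟨ sum-cong-local (All.map (λ l<1+k → summand (ℕ.s≤s⁻¹ l<1+k)) (all-upTo (suc k))) ⟩
  sumℚ (map (λ l → (q ^ℤ ((+ (n ∸ k)) ℤ.* ((+ (2 * l)) - + n - + k)))
                     ℚ.* B n (n ∸ l) q
                     ℚ.* qBinom (n ∸ l) (k ∸ l) (q ℚ.* q))
            (upTo (suc k))) ∎
  where
  m = n ∸ k
  summand : ∀ {l} → l ≤ k →
    B n (n ∸ l) q ℚ.* starFactor q (n ∸ l) m
      ≡ (q ^ℤ ((+ (n ∸ k)) ℤ.* ((+ (2 * l)) - + n - + k))) ℚ.* B n (n ∸ l) q ℚ.* qBinom (n ∸ l) (k ∸ l) (q ℚ.* q)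
  summand {l} l≤k = trans (cong (B n (n ∸ l) q ℚ.*_) (starFactor≡qBinom q k≤n l≤k))
                           (x∙yz≈yx∙z (B n (n ∸ l) q) (q ^ℤ ((+ (n ∸ k)) ℤ.* ((+ (2 * l)) - + n - + k)))
                                      (qBinom (n ∸ l) (k ∸ l) (q ℚ.* q)))
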